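{- Let $\mathbf X=\mathbf f(\mathbf X)$ be the termination system of a probabilistic pushdown automaton, with $n$ variables, assumed clean. Let $c_{\min}$ be the smallest nonzero coefficient of $\mathbf f$ and $\mu_{\min}$ the minimal component of the least fixed point $\mu\mathbf f$. Then $\mu_{\min}\ge c_{\min}^{\,2^{n+1}-1}$.
   Context: A probabilistic pushdown automaton (pPDA) is a tuple $(Q,\Gamma,\delta,\mathrm{Prob})$ with $Q$ a finite set of control states, $\Gamma$ a finite stack alphabet, $\delta\subseteq Q\times\Gamma\times Q\times\Gamma^*$ a finite transition relation (written $pX\to q\alpha$) with $|\alpha|\le2$ for every transition, and $\mathrm{Prob}$ assigning each transition a probability in $(0,1]$ such that for all $p\in Q,X\in\Gamma$ the probabilities of transitions $pX\to q\alpha$ sum to 1. Write $pX\xrightarrow{x}q\alpha$ if the transition has probability $x$. The termination system has one variable $[pXq]$ for each triple $(p,X,q)\in Q\times\Gamma\times Q$ and equations $$[pXq]=\sum_{pX\xrightarrow{x}rYZ}x\sum_{t\in Q}[rYt]\,[tZq]+\sum_{pX\xrightarrow{x}rY}x\,[rYq]+\sum_{pX\xrightarrow{x}q\varepsilon}x.$$ This is a monotone system of polynomials (polynomials with nonnegative coefficients); it has a least nonnegative fixed point $\mu\mathbf f$ (whose components are the termination probabilities). It is clean if for every variable $i$ there is $k$ with $(\mathbf f^k(\mathbf 0))_i>0$.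
   Formalization: The transition probabilities of the probabilistic pushdown automaton are rational numbers, so the coefficients of the termination system are rational as well. -}

module Defs where

open import Data.Nat using (ℕ; zero; suc)
import Data.Nat as ℕ
open import Data.Fin using (Fin)
import Data.Fin as Fin
open import Data.Bool using (Bool; true; false; if_then_else_; _∧_; _∨_)
open import Data.List using (List; []; _∷_; map; concatMap; foldr; allFin)
open import Data.Product using (_×_; _,_; Σ; ∃; ∃-syntax)
open import Data.Sum using (_⊎_)
open import Relation.Nullary.Decidable using (⌊_⌋)
open import Relation.Binary.PropositionalEquality using (_≡_; _≢_)
open import Data.Rational using (ℚ; 0ℚ; 1ℚ; _+_; _*_; _-_; _≤_; _<_)

Σℚ : {A : Set} → List A → (A → ℚ) → ℚ
Σℚ xs f = foldr (λ x acc → f x + acc) 0ℚ xs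

_^ℚ_ : ℚ → ℕ → ℚ
c ^ℚ zero  = 1ℚ
c ^ℚ suc k = c * (c ^ℚ k)

-- Right-hand sides qα of a rule pX → qα with |α| ≤ 2,
-- for control states Fin m and stack alphabet Fin g.
data Rhs (m g : ℕ) : Set where
  pop : Fin m → Rhs m g
  one : Fin m → Fin g → Rhs m g
  two : Fin m → Fin g → Fin g → Rhs m g

allRhs : (m g : ℕ) → List (Rhs m g)
allRhs m g =
  map pop (allFin m)
  Data.List.++ concatMap (λ q → map (one q) (allFin g)) (allFin m)
  Data.List.++ concatMap (λ q → concatMap (λ Y → map (two q Y) (allFin g)) (allFin g)) (allFin m)

-- Prob p X r is the probability of the rule pX → r; the transition relation δ
-- is the support {pX → r | Prob p X r ≠ 0}, so every rule in δ has probability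
-- in (0,1], and the probabilities of the rules of pX sum to 1.
record pPDA (m g : ℕ) : Set where
  field
    Prob      : Fin m → Fin g → Rhs m g → ℚ
    Prob-nonneg : ∀ p X r → 0ℚ ≤ Prob p X r
    Prob-≤1   : ∀ p X r → Prob p X r ≤ 1ℚ
    Prob-sum1 : ∀ p X → Σℚ (allRhs m g) (Prob p X) ≡ 1ℚ

-- Variables [pXq] of the termination system.
Var : ℕ → ℕ → Set
Var m g = Fin m × Fin g × Fin m

nVars : ℕ → ℕ → ℕ
nVars m g = m ℕ.* g ℕ.* m

Val : ℕ → ℕ → Set
Val m g = Var m g → ℚ

module _ {m g : ℕ} (Δ : pPDA m g) where
  open pPDA Δ

  termSys : Val m g → Val m g
  termSys v (p , X , q) =
      Σℚ (allFin m) (λ r → Σℚ (allFin g) (λ Y → Σℚ (allFin g) (λ Z →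
          Prob p X (two r Y Z) * Σℚ (allFin m) (λ t → v (r , Y , t) * v (t , Z , q)))))
    + Σℚ (allFin m) (λ r → Σℚ (allFin g) (λ Y → Prob p X (one r Y) * v (r , Y , q)))
    + Prob p X (pop q)

  iter : ℕ → Val m g
  iter zero    _ = 0ℚ
  iter (suc k) = termSys (iter k)

  Clean : Set
  Clean = ∀ i → ∃[ k ] (0ℚ < iter k i)

  -- Coefficients of the polynomial f_i (after collecting like monomials).
  eqVar : Var m g → Var m g → Bool
  eqVar (a , b , c) (a' , b' , c') = ⌊ a Fin.≟ a' ⌋ ∧ ⌊ b Fin.≟ b' ⌋ ∧ ⌊ c Fin.≟ c' ⌋

  coeff0 : Var m g → ℚ
  coeff0 (p , X , q) = Prob p X (pop q)

  coeff1 : Var m g → Var m g → ℚ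
  coeff1 (p , X , q) (r , Y , s) = if ⌊ s Fin.≟ q ⌋ then Prob p X (one r Y) else 0ℚ

  coeff2 : Var m g → Var m g → Var m g → ℚ
  coeff2 (p , X , q) u v =
    Σℚ (allFin m) (λ r → Σℚ (allFin g) (λ Y → Σℚ (allFin g) (λ Z → Σℚ (allFin m) (λ t →
      if (eqVar u (r , Y , t) ∧ eqVar v (t , Z , q)) ∨ (eqVar v (r , Y , t) ∧ eqVar u (t , Z , q))
      then Prob p X (two r Y Z) else 0ℚ))))

  IsNonzeroCoeff : ℚ → Set
  IsNonzeroCoeff c =
    c ≢ 0ℚ × (  (∃[ i ] c ≡ coeff0 i)
              ⊎ (∃[ i ] ∃[ u ] c ≡ coeff1 i u)
              ⊎ (∃[ i ] ∃[ u ] ∃[ v ] c ≡ coeff2 i u v))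

  IsMinNonzeroCoeff : ℚ → Set
  IsMinNonzeroCoeff c = IsNonzeroCoeff c × (∀ d → IsNonzeroCoeff d → c ≤ d)

  -- b ≤ (μf)_i, where μf = sup_k f^k(0) (Kleene):
  -- for every ε > 0 some iterate exceeds b − ε.
  LfpAtLeast : Var m g → ℚ → Set
  LfpAtLeast i b = ∀ ε → 0ℚ < ε → ∃[ k ] (b - ε < iter k i)

-- Call a variable positive at stage k if it is positive in f^k(0), and let N_k be the number
-- of positive variables. Every positive component of f^k(0) is at least c_min^(2^N_k − 1):
-- a variable turning positive at stage k + 1 does so through a monomial of degree at most two
-- in variables already positive at stage k, so it is at least c_min · (c_min^(2^N_k − 1))²
-- = c_min^(2^(N_k + 1) − 1), while N_{k+1} ≥ N_k + 1. As N_k ≤ n and 0 ≤ c_min ≤ 1, every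
-- positive iterate component, hence (μf)_i, is at least c_min^(2^(n+1) − 1).

module Submission where

open import Defs
open import Data.Nat using (ℕ)
import Data.Nat as ℕ
open import Data.Rational using (ℚ; 1ℚ; _-_)

open import Data.Rational using (0ℚ; _+_; _*_; _≤_; _<_; nonNegative)
open import Data.Rational.Properties
  using (≤-refl; ≤-trans; ≤-reflexive; <-≤-trans; <-irrefl; _<?_; ≮⇒≥; ≤-antisym;
         +-mono-≤; +-monoʳ-≤; +-monoˡ-≤; +-monoʳ-<; +-identityʳ; +-identityˡ; neg-antimono-<;
         *-monoʳ-≤-nonNeg; *-monoˡ-≤-nonNeg; *-zeroˡ; *-zeroʳ; *-identityʳ; *-identityˡ;
         *-assoc; *-comm; *-distribˡ-+; *-distribʳ-+; nonNegative⁻¹; <⇒≢; module ≤-Reasoning)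
import Data.Nat.Properties as ℕₚ
open import Data.Fin using (Fin)
import Data.Fin as Fin
open import Data.List using (List; []; _∷_; allFin; length; filter; cartesianProduct)
open import Data.List.Properties using (length-filter; length-tabulate; length-++; length-map)
open import Data.List.Membership.Propositional using (_∈_)
open import Data.List.Membership.Propositional.Properties using (∈-allFin; ∈-cartesianProduct⁺)
open import Data.List.Relation.Unary.Any using (here; there)
open import Data.Product using (_×_; _,_; ∃-syntax)
open import Data.Sum using (_⊎_; inj₁; inj₂)
open import Data.Bool using (true; false; if_then_else_; T; _∧_; _∨_)
open import Data.Bool.Properties using (T-∧; T-∨; T-≡)
open import Function using (id; Equivalence)
open import Relation.Binary.PropositionalEquality
open import Relation.Nullary using (yes; no; ¬_; contradiction)
open import Relation.Nullary.Decidable using (fromWitness)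
open import Relation.Unary using (Pred; Decidable; _⊆_)
open import Level using (0ℓ)

0≤1 : 0ℚ ≤ 1ℚ
0≤1 = nonNegative⁻¹ 1ℚ

p≤p+q : ∀ p {q} → 0ℚ ≤ q → p ≤ p + q
p≤p+q p 0≤q = ≤-trans (≤-reflexive (sym (+-identityʳ p))) (+-monoʳ-≤ p 0≤q)

p≤q+p : ∀ p {q} → 0ℚ ≤ q → p ≤ q + p
p≤q+p p 0≤q = ≤-trans (≤-reflexive (sym (+-identityˡ p))) (+-monoˡ-≤ p 0≤q)

+-nonNeg : ∀ {p q} → 0ℚ ≤ p → 0ℚ ≤ q → 0ℚ ≤ p + q
+-nonNeg {p} 0≤p 0≤q = ≤-trans 0≤p (p≤p+q p 0≤q)

*-mono-≤-nonNeg : ∀ {a b c d} → 0ℚ ≤ a → a ≤ b → 0ℚ ≤ c → c ≤ d → a * c ≤ b * d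
*-mono-≤-nonNeg {a} {b} {c} {d} 0≤a a≤b 0≤c c≤d =
  ≤-trans (*-monoʳ-≤-nonNeg c {{nonNegative 0≤c}} a≤b)
          (*-monoˡ-≤-nonNeg b {{nonNegative (≤-trans 0≤a a≤b)}} c≤d)

*-nonNeg : ∀ {p q} → 0ℚ ≤ p → 0ℚ ≤ q → 0ℚ ≤ p * q
*-nonNeg 0≤p 0≤q = ≤-trans (≤-reflexive (sym (*-zeroˡ 0ℚ))) (*-mono-≤-nonNeg ≤-refl 0≤p ≤-refl 0≤q)

0<p+q⇒0<p⊎0<q : ∀ {p q} → 0ℚ < p + q → 0ℚ < p ⊎ 0ℚ < q
0<p+q⇒0<p⊎0<q {p} {q} 0<p+q with 0ℚ <? p | 0ℚ <? q
... | yes 0<p | _       = inj₁ 0<p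
... | no _    | yes 0<q = inj₂ 0<q
... | no 0≮p  | no 0≮q  =
  contradiction (<-≤-trans 0<p+q (+-mono-≤ (≮⇒≥ 0≮p) (≮⇒≥ 0≮q))) (<-irrefl refl)

0<p*q⇒0<p×0<q : ∀ {p q} → 0ℚ ≤ p → 0ℚ ≤ q → 0ℚ < p * q → 0ℚ < p × 0ℚ < q
0<p*q⇒0<p×0<q {p} {q} 0≤p 0≤q 0<pq with 0ℚ <? p | 0ℚ <? q
... | yes 0<p | yes 0<q = 0<p , 0<q
... | no 0≮p  | _       =
  contradiction (subst (λ x → 0ℚ < x * q) (≤-antisym (≮⇒≥ 0≮p) 0≤p) 0<pq) (<-irrefl (sym (*-zeroˡ q)))
... | _       | no 0≮q  =
  contradiction (subst (λ x → 0ℚ < p * x) (≤-antisym (≮⇒≥ 0≮q) 0≤q) 0<pq) (<-irrefl (sym (*-zeroʳ p)))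

p-ε<p : ∀ p {ε} → 0ℚ < ε → p - ε < p
p-ε<p p 0<ε = <-≤-trans (+-monoʳ-< p (neg-antimono-< 0<ε)) (≤-reflexive (+-identityʳ p))

module _ {A : Set} where

  Σ-nonNeg : ∀ xs {f : A → ℚ} → (∀ x → 0ℚ ≤ f x) → 0ℚ ≤ Σℚ xs f
  Σ-nonNeg []       _   = ≤-refl
  Σ-nonNeg (x ∷ xs) 0≤f = +-nonNeg (0≤f x) (Σ-nonNeg xs 0≤f)

  Σ-mono-≤ : ∀ xs {f h : A → ℚ} → (∀ x → f x ≤ h x) → Σℚ xs f ≤ Σℚ xs h
  Σ-mono-≤ []       _   = ≤-refl
  Σ-mono-≤ (x ∷ xs) f≤h = +-mono-≤ (f≤h x) (Σ-mono-≤ xs f≤h)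

  Σ-positive⁻¹ : ∀ xs (f : A → ℚ) → 0ℚ < Σℚ xs f → ∃[ x ] 0ℚ < f x
  Σ-positive⁻¹ []       f 0<0 = contradiction 0<0 (<-irrefl refl)
  Σ-positive⁻¹ (x ∷ xs) f 0<Σ with 0<p+q⇒0<p⊎0<q {f x} 0<Σ
  ... | inj₁ 0<fx = x , 0<fx
  ... | inj₂ 0<Σ′ = Σ-positive⁻¹ xs f 0<Σ′

  term≤Σ : ∀ {xs} {f : A → ℚ} → (∀ x → 0ℚ ≤ f x) → ∀ {x} → x ∈ xs → f x ≤ Σℚ xs f
  term≤Σ {y ∷ xs} {f} 0≤f (here refl) = p≤p+q (f y) (Σ-nonNeg xs 0≤f)
  term≤Σ {y ∷ xs} {f} 0≤f (there x∈) = ≤-trans (term≤Σ 0≤f x∈) (p≤q+p _ (0≤f y))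

  *-distribˡ-Σ : ∀ c xs (f : A → ℚ) → c * Σℚ xs f ≡ Σℚ xs (λ x → c * f x)
  *-distribˡ-Σ c []       f = *-zeroʳ c
  *-distribˡ-Σ c (x ∷ xs) f = trans (*-distribˡ-+ c (f x) _) (cong (c * f x +_) (*-distribˡ-Σ c xs f))

  *-distribʳ-Σ : ∀ c xs (f : A → ℚ) → Σℚ xs f * c ≡ Σℚ xs (λ x → f x * c)
  *-distribʳ-Σ c []       f = *-zeroˡ c
  *-distribʳ-Σ c (x ∷ xs) f = trans (*-distribʳ-+ c (f x) _) (cong (f x * c +_) (*-distribʳ-Σ c xs f))

  Σ-*ʳ-≤ : ∀ c xs {f h : A → ℚ} → (∀ x → f x * c ≤ h x) → Σℚ xs f * c ≤ Σℚ xs h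
  Σ-*ʳ-≤ c xs {f} fc≤h = ≤-trans (≤-reflexive (*-distribʳ-Σ c xs f)) (Σ-mono-≤ xs fc≤h)

term≤ΣallFin : ∀ {n} {f : Fin n → ℚ} → (∀ x → 0ℚ ≤ f x) → ∀ x → f x ≤ Σℚ (allFin n) f
term≤ΣallFin 0≤f x = term≤Σ 0≤f (∈-allFin x)

Σ⁴ : ∀ {a b c d} → (Fin a → Fin b → Fin c → Fin d → ℚ) → ℚ
Σ⁴ f = Σℚ (allFin _) λ w → Σℚ (allFin _) λ x → Σℚ (allFin _) λ y → Σℚ (allFin _) (f w x y)

term≤Σ⁴ : ∀ {a b c d} (f : Fin a → Fin b → Fin c → Fin d → ℚ) → (∀ w x y z → 0ℚ ≤ f w x y z) →
          ∀ w x y z → f w x y z ≤ Σ⁴ f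
term≤Σ⁴ {a} {b} {c} {d} f 0≤f w x y z =
  ≤-trans (term≤ΣallFin (0≤f w x y) z)
  (≤-trans (term≤ΣallFin (λ y → Σ-nonNeg (allFin d) (0≤f w x y)) y)
  (≤-trans (term≤ΣallFin (λ x → Σ-nonNeg (allFin c) λ y → Σ-nonNeg (allFin d) (0≤f w x y)) x)
           (term≤ΣallFin (λ w → Σ-nonNeg (allFin b) λ x → Σ-nonNeg (allFin c) λ y →
                                  Σ-nonNeg (allFin d) (0≤f w x y)) w)))

Σ⁴-*ʳ-≤ : ∀ {a b c d} (f : Fin a → Fin b → Fin c → Fin d → ℚ) (P : Fin a → Fin b → Fin c → ℚ)
          (h : Fin a → Fin b → Fin c → Fin d → ℚ) M →
          (∀ w x y z → f w x y z * M ≤ P w x y * h w x y z) →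
          Σ⁴ f * M ≤ Σℚ (allFin a) λ w → Σℚ (allFin b) λ x → Σℚ (allFin c) λ y →
                       P w x y * Σℚ (allFin d) (h w x y)
Σ⁴-*ʳ-≤ {a} {b} {c} {d} f P h M fM≤Ph =
  Σ-*ʳ-≤ M (allFin a) {f = λ w → Σℚ (allFin b) λ x → Σℚ (allFin c) λ y → Σℚ (allFin d) (f w x y)}
  λ w →
  Σ-*ʳ-≤ M (allFin b) {f = λ x → Σℚ (allFin c) λ y → Σℚ (allFin d) (f w x y)} λ x →
  Σ-*ʳ-≤ M (allFin c) {f = λ y → Σℚ (allFin d) (f w x y)} λ y →
    ≤-trans (Σ-*ʳ-≤ M (allFin d) {f = f w x y} (fM≤Ph w x y))
            (≤-reflexive (sym (*-distribˡ-Σ (P w x y) (allFin d) (h w x y))))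

^ℚ-+ : ∀ c a b → c ^ℚ (a ℕ.+ b) ≡ c ^ℚ a * c ^ℚ b
^ℚ-+ c ℕ.zero    b = sym (*-identityˡ _)
^ℚ-+ c (ℕ.suc a) b = trans (cong (c *_) (^ℚ-+ c a b)) (sym (*-assoc c _ _))

^ℚ-nonNeg : ∀ {c} → 0ℚ ≤ c → ∀ a → 0ℚ ≤ c ^ℚ a
^ℚ-nonNeg 0≤c ℕ.zero    = 0≤1
^ℚ-nonNeg 0≤c (ℕ.suc a) = *-nonNeg 0≤c (^ℚ-nonNeg 0≤c a)

module _ {c : ℚ} (0≤c : 0ℚ ≤ c) (c≤1 : c ≤ 1ℚ) where

  ^ℚ-≤1 : ∀ a → c ^ℚ a ≤ 1ℚ
  ^ℚ-≤1 ℕ.zero    = ≤-refl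
  ^ℚ-≤1 (ℕ.suc a) =
    ≤-trans (*-mono-≤-nonNeg 0≤c c≤1 (^ℚ-nonNeg 0≤c a) (^ℚ-≤1 a)) (≤-reflexive (*-identityˡ 1ℚ))

  ^ℚ-antitone : ∀ {a b} → a ℕ.≤ b → c ^ℚ b ≤ c ^ℚ a
  ^ℚ-antitone {b = b} ℕ.z≤n = ^ℚ-≤1 b
  ^ℚ-antitone (ℕ.s≤s a≤b)   = *-monoˡ-≤-nonNeg c {{nonNegative 0≤c}} (^ℚ-antitone a≤b)

mersenne : ℕ → ℕ
mersenne ℕ.zero    = 0
mersenne (ℕ.suc n) = ℕ.suc (mersenne n ℕ.+ mersenne n)

mersenne-mono : ∀ {a b} → a ℕ.≤ b → mersenne a ℕ.≤ mersenne b
mersenne-mono ℕ.z≤n       = ℕ.z≤n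
mersenne-mono (ℕ.s≤s a≤b) = ℕ.s≤s (ℕₚ.+-mono-≤ (mersenne-mono a≤b) (mersenne-mono a≤b))

suc-mersenne : ∀ n → ℕ.suc (mersenne n) ≡ 2 ℕ.^ n
suc-mersenne ℕ.zero    = refl
suc-mersenne (ℕ.suc n) = begin
  ℕ.suc (ℕ.suc (mersenne n ℕ.+ mersenne n)) ≡⟨ cong ℕ.suc (sym (ℕₚ.+-suc (mersenne n) (mersenne n))) ⟩
  ℕ.suc (mersenne n) ℕ.+ ℕ.suc (mersenne n)  ≡⟨ cong₂ ℕ._+_ (suc-mersenne n) (suc-mersenne n) ⟩
  2 ℕ.^ n ℕ.+ 2 ℕ.^ n                         ≡⟨ cong (2 ℕ.^ n ℕ.+_) (sym (ℕₚ.+-identityʳ _)) ⟩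
  2 ℕ.^ ℕ.suc n                               ∎
  where open ≡-Reasoning

mersenne≡2^∸1 : ∀ n → mersenne n ≡ 2 ℕ.^ n ℕ.∸ 1
mersenne≡2^∸1 n = cong (ℕ._∸ 1) (suc-mersenne n)

module _ {A : Set} {P Q : Pred A 0ℓ} (P? : Decidable P) (Q? : Decidable Q) (P⊆Q : P ⊆ Q) where

  length-filter-mono : ∀ xs → length (filter P? xs) ℕ.≤ length (filter Q? xs)
  length-filter-mono []       = ℕ.z≤n
  length-filter-mono (x ∷ xs) with P? x | Q? x
  ... | yes _  | yes _   = ℕ.s≤s (length-filter-mono xs)
  ... | yes px | no ¬qx  = contradiction (P⊆Q px) ¬qx
  ... | no _   | yes _   = ℕₚ.m≤n⇒m≤1+n (length-filter-mono xs)
  ... | no _   | no _    = length-filter-mono xs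

  length-filter-strict : ∀ {x xs} → x ∈ xs → ¬ P x → Q x →
                         length (filter P? xs) ℕ.< length (filter Q? xs)
  length-filter-strict {xs = y ∷ xs} (here refl) ¬py qy with P? y | Q? y
  ... | yes py | _      = contradiction py ¬py
  ... | no _   | no ¬qy = contradiction qy ¬qy
  ... | no _   | yes _  = ℕ.s≤s (length-filter-mono xs)
  length-filter-strict {xs = y ∷ xs} (there x∈) ¬px qx with P? y | Q? y
  ... | yes _  | yes _  = ℕ.s≤s (length-filter-strict x∈ ¬px qx)
  ... | yes py | no ¬qy = contradiction (P⊆Q py) ¬qy
  ... | no _   | yes _  = ℕₚ.m≤n⇒m≤1+n (length-filter-strict x∈ ¬px qx)
  ... | no _   | no _   = length-filter-strict x∈ ¬px qx

length-cartesianProduct : ∀ {A B : Set} (xs : List A) (ys : List B) →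
                          length (cartesianProduct xs ys) ≡ length xs ℕ.* length ys
length-cartesianProduct []       ys = refl
length-cartesianProduct (x ∷ xs) ys = begin
  length (Data.List.map (x ,_) ys Data.List.++ cartesianProduct xs ys)
    ≡⟨ length-++ (Data.List.map (x ,_) ys) ⟩
  length (Data.List.map (x ,_) ys) ℕ.+ length (cartesianProduct xs ys)
    ≡⟨ cong₂ ℕ._+_ (length-map (x ,_) ys) (length-cartesianProduct xs ys) ⟩
  length ys ℕ.+ length xs ℕ.* length ys ∎
  where open ≡-Reasoning

allVars : (m g : ℕ) → List (Var m g)
allVars m g = cartesianProduct (allFin m) (cartesianProduct (allFin g) (allFin m))

∈-allVars : ∀ {m g} (j : Var m g) → j ∈ allVars m g
∈-allVars (p , X , q) = ∈-cartesianProduct⁺ (∈-allFin p) (∈-cartesianProduct⁺ (∈-allFin X) (∈-allFin q))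

length-allVars : ∀ m g → length (allVars m g) ≡ nVars m g
length-allVars m g = begin
  length (allVars m g)                                     ≡⟨ length-cartesianProduct (allFin m) _ ⟩
  length (allFin m) ℕ.* length (cartesianProduct (allFin g) (allFin m))
    ≡⟨ cong₂ ℕ._*_ (length-tabulate {n = m} id) (trans (length-cartesianProduct (allFin g) (allFin m))
                   (cong₂ ℕ._*_ (length-tabulate {n = g} id) (length-tabulate {n = m} id))) ⟩
  m ℕ.* (g ℕ.* m)                                          ≡⟨ sym (ℕₚ.*-assoc m g m) ⟩
  nVars m g                                                ∎
  where open ≡-Reasoning

if-nonNeg : ∀ b {x} → 0ℚ ≤ x → 0ℚ ≤ (if b then x else 0ℚ)
if-nonNeg true  0≤x = 0≤x
if-nonNeg false _   = ≤-refl

if-T : ∀ {b} {x y : ℚ} → T b → (if b then x else y) ≡ x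
if-T {true} _ = refl

module TerminationSystem {m g : ℕ} (Δ : pPDA m g) where
  open pPDA Δ

  NonNeg : Val m g → Set
  NonNeg v = ∀ j → 0ℚ ≤ v j

  -- termSys Δ v i unfolds to pushPart v i + stepPart v i + coeff0 Δ i, for i = (p , X , q).
  pushTerm : Val m g → Var m g → Fin m → Fin g → Fin g → ℚ
  pushTerm v (p , X , q) r Y Z = Prob p X (two r Y Z) * Σℚ (allFin m) (λ t → v (r , Y , t) * v (t , Z , q))

  pushPart : Val m g → Var m g → ℚ
  pushPart v i = Σℚ (allFin m) λ r → Σℚ (allFin g) λ Y → Σℚ (allFin g) (pushTerm v i r Y)

  stepTerm : Val m g → Var m g → Fin m → Fin g → ℚ
  stepTerm v (p , X , q) r Y = Prob p X (one r Y) * v (r , Y , q)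

  stepPart : Val m g → Var m g → ℚ
  stepPart v i = Σℚ (allFin m) λ r → Σℚ (allFin g) (stepTerm v i r)

  pushPart-nonNeg : ∀ {v} → NonNeg v → ∀ i → 0ℚ ≤ pushPart v i
  pushPart-nonNeg 0≤v (p , X , q) =
    Σ-nonNeg (allFin m) λ r → Σ-nonNeg (allFin g) λ Y → Σ-nonNeg (allFin g) λ Z →
      *-nonNeg (Prob-nonneg p X (two r Y Z)) (Σ-nonNeg (allFin m) λ t → *-nonNeg (0≤v _) (0≤v _))

  stepPart-nonNeg : ∀ {v} → NonNeg v → ∀ i → 0ℚ ≤ stepPart v i
  stepPart-nonNeg 0≤v (p , X , q) =
    Σ-nonNeg (allFin m) λ r → Σ-nonNeg (allFin g) λ Y → *-nonNeg (Prob-nonneg p X (one r Y)) (0≤v _)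

  termSys-nonNeg : ∀ {v} → NonNeg v → NonNeg (termSys Δ v)
  termSys-nonNeg 0≤v i@(p , X , q) =
    +-nonNeg (+-nonNeg (pushPart-nonNeg 0≤v i) (stepPart-nonNeg 0≤v i)) (Prob-nonneg p X (pop q))

  pushPart≤termSys : ∀ {v} → NonNeg v → ∀ i → pushPart v i ≤ termSys Δ v i
  pushPart≤termSys 0≤v i@(p , X , q) =
    ≤-trans (p≤p+q _ (stepPart-nonNeg 0≤v i)) (p≤p+q _ (Prob-nonneg p X (pop q)))

  stepPart≤termSys : ∀ {v} → NonNeg v → ∀ i → stepPart v i ≤ termSys Δ v i
  stepPart≤termSys 0≤v i@(p , X , q) =
    ≤-trans (p≤q+p _ (pushPart-nonNeg 0≤v i)) (p≤p+q _ (Prob-nonneg p X (pop q)))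

  coeff0≤termSys : ∀ {v} → NonNeg v → ∀ i → coeff0 Δ i ≤ termSys Δ v i
  coeff0≤termSys 0≤v i = p≤q+p _ (+-nonNeg (pushPart-nonNeg 0≤v i) (stepPart-nonNeg 0≤v i))

  termSys-mono : ∀ {v w} → NonNeg v → (∀ j → v j ≤ w j) → ∀ i → termSys Δ v i ≤ termSys Δ w i
  termSys-mono {v} {w} 0≤v v≤w i@(p , X , q) = +-mono-≤ (+-mono-≤ push-mono step-mono) ≤-refl
    where
      push-mono : pushPart v i ≤ pushPart w i
      push-mono = Σ-mono-≤ (allFin m) λ r → Σ-mono-≤ (allFin g) λ Y → Σ-mono-≤ (allFin g) λ Z →
        *-mono-≤-nonNeg (Prob-nonneg p X (two r Y Z)) ≤-refl
          (Σ-nonNeg (allFin m) λ t → *-nonNeg (0≤v _) (0≤v _))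
          (Σ-mono-≤ (allFin m) λ t → *-mono-≤-nonNeg (0≤v _) (v≤w _) (0≤v _) (v≤w _))
      step-mono : stepPart v i ≤ stepPart w i
      step-mono = Σ-mono-≤ (allFin m) λ r → Σ-mono-≤ (allFin g) λ Y →
        *-mono-≤-nonNeg (Prob-nonneg p X (one r Y)) ≤-refl (0≤v _) (v≤w _)

  iter-nonNeg : ∀ k → NonNeg (iter Δ k)
  iter-nonNeg ℕ.zero    _ = ≤-refl
  iter-nonNeg (ℕ.suc k)   = termSys-nonNeg (iter-nonNeg k)

  iter-increasing : ∀ k j → iter Δ k j ≤ iter Δ (ℕ.suc k) j
  iter-increasing ℕ.zero    = iter-nonNeg 1
  iter-increasing (ℕ.suc k) = termSys-mono (iter-nonNeg k) (iter-increasing k)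

  data PositiveSummand (v : Val m g) : Var m g → Set where
    pop⁺ : ∀ {p X q} → 0ℚ < Prob p X (pop q) → PositiveSummand v (p , X , q)
    one⁺ : ∀ {p X q} r Y → 0ℚ < Prob p X (one r Y) → 0ℚ < v (r , Y , q) → PositiveSummand v (p , X , q)
    two⁺ : ∀ {p X q} r Y Z t → 0ℚ < Prob p X (two r Y Z) →
           0ℚ < v (r , Y , t) → 0ℚ < v (t , Z , q) → PositiveSummand v (p , X , q)

  positiveSummand : ∀ {v} → NonNeg v → ∀ i → 0ℚ < termSys Δ v i → PositiveSummand v i
  positiveSummand {v} 0≤v i@(p , X , q) 0<f with 0<p+q⇒0<p⊎0<q {pushPart v i + stepPart v i} 0<f
  ... | inj₂ 0<P = pop⁺ 0<P
  ... | inj₁ 0<f′ with 0<p+q⇒0<p⊎0<q {pushPart v i} 0<f′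
  ... | inj₂ 0<step =
    let r , 0<Σ   = Σ-positive⁻¹ (allFin m) (λ r → Σℚ (allFin g) (stepTerm v i r)) 0<step
        Y , 0<Pv  = Σ-positive⁻¹ (allFin g) (stepTerm v i r) 0<Σ
        0<P , 0<v = 0<p*q⇒0<p×0<q (Prob-nonneg p X (one r Y)) (0≤v _) 0<Pv
    in one⁺ r Y 0<P 0<v
  ... | inj₁ 0<push =
    let r , 0<Σ     = Σ-positive⁻¹ (allFin m) (λ r → Σℚ (allFin g) λ Y → Σℚ (allFin g) (pushTerm v i r Y))
                        0<push
        Y , 0<Σ′    = Σ-positive⁻¹ (allFin g) (λ Y → Σℚ (allFin g) (pushTerm v i r Y)) 0<Σ
        Z , 0<PΣ    = Σ-positive⁻¹ (allFin g) (pushTerm v i r Y) 0<Σ′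
        0<P , 0<Σvv = 0<p*q⇒0<p×0<q (Prob-nonneg p X (two r Y Z))
                        (Σ-nonNeg (allFin m) λ t → *-nonNeg (0≤v (r , Y , t)) (0≤v (t , Z , q))) 0<PΣ
        t , 0<vv    = Σ-positive⁻¹ (allFin m) (λ t → v (r , Y , t) * v (t , Z , q)) 0<Σvv
        0<vu , 0<vw = 0<p*q⇒0<p×0<q (0≤v _) (0≤v _) 0<vv
    in two⁺ r Y Z t 0<P 0<vu 0<vw

  eqVar-refl : ∀ u → T (eqVar Δ u u)
  eqVar-refl (a , b , c) with a Fin.≟ a | b Fin.≟ b | c Fin.≟ c
  ... | yes _  | yes _  | yes _  = _
  ... | no a≢a | _      | _      = contradiction refl a≢a
  ... | yes _  | no b≢b | _      = contradiction refl b≢b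
  ... | yes _  | yes _  | no c≢c = contradiction refl c≢c

  eqVar-sound : ∀ {u w} → T (eqVar Δ u w) → u ≡ w
  eqVar-sound {a , b , c} {a′ , b′ , c′} h with a Fin.≟ a′ | b Fin.≟ b′ | c Fin.≟ c′
  eqVar-sound _  | yes refl | yes refl | yes refl = refl
  eqVar-sound () | no _     | _        | _
  eqVar-sound () | yes _    | no _     | _
  eqVar-sound () | yes _    | yes _    | no _

  -- coeff2 i u w is definitionally Σ⁴ (matchSummand i u w).
  matchSummand : Var m g → Var m g → Var m g → Fin m → Fin g → Fin g → Fin m → ℚ
  matchSummand (p , X , q) u w r Y Z t =
    if (eqVar Δ u (r , Y , t) ∧ eqVar Δ w (t , Z , q)) ∨ (eqVar Δ w (r , Y , t) ∧ eqVar Δ u (t , Z , q))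
    then Prob p X (two r Y Z) else 0ℚ

  matchSummand-nonNeg : ∀ i u w r Y Z t → 0ℚ ≤ matchSummand i u w r Y Z t
  matchSummand-nonNeg (p , X , q) u w r Y Z t = if-nonNeg _ (Prob-nonneg p X (two r Y Z))

  matchSummand-monomial : ∀ {v} → NonNeg v → ∀ p X q u w r Y Z t →
    matchSummand (p , X , q) u w r Y Z t * (v u * v w) ≤ Prob p X (two r Y Z) * (v (r , Y , t) * v (t , Z , q))
  matchSummand-monomial {v} 0≤v p X q u w r Y Z t
    with (eqVar Δ u (r , Y , t) ∧ eqVar Δ w (t , Z , q)) ∨ (eqVar Δ w (r , Y , t) ∧ eqVar Δ u (t , Z , q)) in eq
  ... | false = ≤-trans (≤-reflexive (*-zeroˡ (v u * v w)))
                        (*-nonNeg (Prob-nonneg p X (two r Y Z)) (*-nonNeg (0≤v _) (0≤v _)))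
  ... | true with Equivalence.to T-∨ (Equivalence.from T-≡ eq)
  ...   | inj₁ h = let u≡ , w≡ = Equivalence.to T-∧ h in
    ≤-reflexive (cong (Prob p X (two r Y Z) *_) (cong₂ _*_ (cong v (eqVar-sound u≡)) (cong v (eqVar-sound w≡))))
  ...   | inj₂ h = let w≡ , u≡ = Equivalence.to T-∧ h in
    ≤-reflexive (cong (Prob p X (two r Y Z) *_)
      (trans (*-comm (v u) (v w)) (cong₂ _*_ (cong v (eqVar-sound w≡)) (cong v (eqVar-sound u≡)))))

  coeff2-monomial≤termSys : ∀ {v} → NonNeg v → ∀ i u w → coeff2 Δ i u w * (v u * v w) ≤ termSys Δ v i
  coeff2-monomial≤termSys {v} 0≤v i@(p , X , q) u w =
    ≤-trans (Σ⁴-*ʳ-≤ (matchSummand i u w) (λ r Y Z → Prob p X (two r Y Z))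
                     (λ r Y Z t → v (r , Y , t) * v (t , Z , q)) (v u * v w)
                     (matchSummand-monomial 0≤v p X q u w))
            (pushPart≤termSys 0≤v i)

  stepTerm≤termSys : ∀ {v} → NonNeg v → ∀ p X q r Y →
                     Prob p X (one r Y) * v (r , Y , q) ≤ termSys Δ v (p , X , q)
  stepTerm≤termSys 0≤v p X q r Y =
    ≤-trans (≤-trans (term≤ΣallFin (λ Y′ → *-nonNeg (Prob-nonneg p X (one r Y′)) (0≤v _)) Y)
                     (term≤ΣallFin (λ r′ → Σ-nonNeg (allFin g) λ Y′ →
                                             *-nonNeg (Prob-nonneg p X (one r′ Y′)) (0≤v _)) r))
            (stepPart≤termSys 0≤v (p , X , q))

  Prob-two≤coeff2 : ∀ p X q r Y Z t → Prob p X (two r Y Z) ≤ coeff2 Δ (p , X , q) (r , Y , t) (t , Z , q)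
  Prob-two≤coeff2 p X q r Y Z t =
    ≤-trans (≤-reflexive (sym (if-T matched)))
            (term≤Σ⁴ (matchSummand (p , X , q) u w) (matchSummand-nonNeg (p , X , q) u w) r Y Z t)
    where
      u w : Var m g
      u = r , Y , t
      w = t , Z , q
      matched : T ((eqVar Δ u u ∧ eqVar Δ w w) ∨ (eqVar Δ w u ∧ eqVar Δ u w))
      matched = Equivalence.from T-∨ (inj₁ (Equivalence.from T-∧ (eqVar-refl u , eqVar-refl w)))

  coeff1-diag : ∀ p X q r Y → coeff1 Δ (p , X , q) (r , Y , q) ≡ Prob p X (one r Y)
  coeff1-diag p X q r Y =
    cong (if_then Prob p X (one r Y) else 0ℚ) (Equivalence.to T-≡ (fromWitness {a? = q Fin.≟ q} refl))

  nonzeroCoeff-nonNeg : ∀ {d} → IsNonzeroCoeff Δ d → 0ℚ ≤ d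
  nonzeroCoeff-nonNeg (_ , inj₁ ((p , X , q) , refl)) = Prob-nonneg p X (pop q)
  nonzeroCoeff-nonNeg (_ , inj₂ (inj₁ ((p , X , q) , (r , Y , s) , refl))) = if-nonNeg _ (Prob-nonneg p X (one r Y))
  nonzeroCoeff-nonNeg (_ , inj₂ (inj₂ (i , u , w , refl))) =
    Σ-nonNeg (allFin m) λ r → Σ-nonNeg (allFin g) λ Y → Σ-nonNeg (allFin g) λ Z →
      Σ-nonNeg (allFin m) (matchSummand-nonNeg i u w r Y Z)

  pop-isNonzeroCoeff : ∀ {p X q} → 0ℚ < Prob p X (pop q) → IsNonzeroCoeff Δ (Prob p X (pop q))
  pop-isNonzeroCoeff {p} {X} {q} 0<P = ≢-sym (<⇒≢ 0<P) , inj₁ ((p , X , q) , refl)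

  one-isNonzeroCoeff : ∀ {p X} q {r Y} → 0ℚ < Prob p X (one r Y) → IsNonzeroCoeff Δ (Prob p X (one r Y))
  one-isNonzeroCoeff {p} {X} q {r} {Y} 0<P =
    ≢-sym (<⇒≢ 0<P) , inj₂ (inj₁ ((p , X , q) , (r , Y , q) , sym (coeff1-diag p X q r Y)))

  two-isNonzeroCoeff : ∀ {p X q} r Y Z t → 0ℚ < Prob p X (two r Y Z) →
                       IsNonzeroCoeff Δ (coeff2 Δ (p , X , q) (r , Y , t) (t , Z , q))
  two-isNonzeroCoeff {p} {X} {q} r Y Z t 0<P =
    ≢-sym (<⇒≢ (<-≤-trans 0<P (Prob-two≤coeff2 p X q r Y Z t))) ,
    inj₂ (inj₂ ((p , X , q) , (r , Y , t) , (t , Z , q) , refl))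

  -- Tracing a positive iterate down to a pop or one-symbol transition exhibits a nonzero
  -- coefficient that is a probability; this is what makes c_min ≤ 1.
  ∃nonzeroCoeff≤1 : ∀ k i → 0ℚ < iter Δ k i → ∃[ d ] IsNonzeroCoeff Δ d × d ≤ 1ℚ
  ∃nonzeroCoeff≤1 ℕ.zero    i 0<0 = contradiction 0<0 (<-irrefl refl)
  ∃nonzeroCoeff≤1 (ℕ.suc k) i 0<f with positiveSummand (iter-nonNeg k) i 0<f
  ... | pop⁺ {p} {X} {q} 0<P           = _ , pop-isNonzeroCoeff 0<P , Prob-≤1 p X (pop q)
  ... | one⁺ {p} {X} {q} r Y 0<P _     = _ , one-isNonzeroCoeff q 0<P , Prob-≤1 p X (one r Y)
  ... | two⁺ r Y Z t _ 0<u _           = ∃nonzeroCoeff≤1 k (r , Y , t) 0<u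

  Positive : ℕ → Pred (Var m g) 0ℓ
  Positive k j = 0ℚ < iter Δ k j

  positive? : ∀ k → Decidable (Positive k)
  positive? k j = 0ℚ <? iter Δ k j

  Positive-mono : ∀ k → Positive k ⊆ Positive (ℕ.suc k)
  Positive-mono k {j} 0<j = <-≤-trans 0<j (iter-increasing k j)

  positiveCount : ℕ → ℕ
  positiveCount k = length (filter (positive? k) (allVars m g))

  positiveCount-mono : ∀ k → positiveCount k ℕ.≤ positiveCount (ℕ.suc k)
  positiveCount-mono k = length-filter-mono (positive? k) (positive? (ℕ.suc k)) (Positive-mono k) (allVars m g)

  positiveCount-strict : ∀ k {i} → ¬ Positive k i → Positive (ℕ.suc k) i →
                         positiveCount k ℕ.< positiveCount (ℕ.suc k)
  positiveCount-strict k {i} =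
    length-filter-strict (positive? k) (positive? (ℕ.suc k)) (Positive-mono k) (∈-allVars i)

  positiveCount≤nVars : ∀ k → positiveCount k ℕ.≤ nVars m g
  positiveCount≤nVars k =
    ℕₚ.≤-trans (length-filter (positive? k) (allVars m g)) (ℕₚ.≤-reflexive (length-allVars m g))

module LowerBound {m g : ℕ} (Δ : pPDA m g) {c : ℚ} (0≤c : 0ℚ ≤ c) (c≤1 : c ≤ 1ℚ)
                  (c≤coeff : ∀ d → IsNonzeroCoeff Δ d → c ≤ d) where
  open pPDA Δ
  open TerminationSystem Δ
  open ≤-Reasoning

  termSys-lowerBound : ∀ {v} E → NonNeg v → (∀ j → 0ℚ < v j → c ^ℚ E ≤ v j) →
                       ∀ i → 0ℚ < termSys Δ v i → c ^ℚ ℕ.suc (E ℕ.+ E) ≤ termSys Δ v i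
  termSys-lowerBound {v} E 0≤v bound i 0<f with positiveSummand 0≤v i 0<f
  ... | pop⁺ {p} {X} {q} 0<P = begin
    c * c ^ℚ (E ℕ.+ E)   ≤⟨ *-monoˡ-≤-nonNeg c {{nonNegative 0≤c}} (^ℚ-≤1 0≤c c≤1 (E ℕ.+ E)) ⟩
    c * 1ℚ               ≡⟨ *-identityʳ c ⟩
    c                    ≤⟨ c≤coeff _ (pop-isNonzeroCoeff 0<P) ⟩
    Prob p X (pop q)     ≤⟨ coeff0≤termSys 0≤v i ⟩
    termSys Δ v i        ∎
  ... | one⁺ {p} {X} {q} r Y 0<P 0<v = begin
    c ^ℚ ℕ.suc (E ℕ.+ E)               ≤⟨ ^ℚ-antitone 0≤c c≤1 (ℕ.s≤s (ℕₚ.m≤m+n E E)) ⟩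
    c * c ^ℚ E                         ≤⟨ *-mono-≤-nonNeg 0≤c (c≤coeff _ (one-isNonzeroCoeff q 0<P))
                                                          (^ℚ-nonNeg 0≤c E) (bound _ 0<v) ⟩
    Prob p X (one r Y) * v (r , Y , q) ≤⟨ stepTerm≤termSys 0≤v p X q r Y ⟩
    termSys Δ v i                      ∎
  ... | two⁺ {p} {X} {q} r Y Z t 0<P 0<u 0<w = begin
    c * c ^ℚ (E ℕ.+ E)                   ≡⟨ cong (c *_) (^ℚ-+ c E E) ⟩
    c * (c ^ℚ E * c ^ℚ E)                ≤⟨ *-mono-≤-nonNeg 0≤c (c≤coeff _ (two-isNonzeroCoeff r Y Z t 0<P))
                                              (*-nonNeg (^ℚ-nonNeg 0≤c E) (^ℚ-nonNeg 0≤c E))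
                                              (*-mono-≤-nonNeg (^ℚ-nonNeg 0≤c E) (bound _ 0<u)
                                                               (^ℚ-nonNeg 0≤c E) (bound _ 0<w)) ⟩
    coeff2 Δ i u w * (v u * v w)         ≤⟨ coeff2-monomial≤termSys 0≤v i u w ⟩
    termSys Δ v i                        ∎
    where
      u w : Var m g
      u = r , Y , t
      w = t , Z , q

  iter-lowerBound : ∀ k i → Positive k i → c ^ℚ mersenne (positiveCount k) ≤ iter Δ k i
  iter-lowerBound ℕ.zero    i 0<0 = contradiction 0<0 (<-irrefl refl)
  iter-lowerBound (ℕ.suc k) i 0<f with positive? k i
  ... | yes 0<i = ≤-trans (^ℚ-antitone 0≤c c≤1 (mersenne-mono (positiveCount-mono k)))
                          (≤-trans (iter-lowerBound k i 0<i) (iter-increasing k i))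
  ... | no 0≮i  = ≤-trans (^ℚ-antitone 0≤c c≤1 (mersenne-mono (positiveCount-strict k 0≮i 0<f)))
                          (termSys-lowerBound (mersenne (positiveCount k)) (iter-nonNeg k) (iter-lowerBound k) i 0<f)

lemma4p1 : {m g : ℕ} (Δ : pPDA m g) → Clean Δ → (cmin : ℚ) → IsMinNonzeroCoeff Δ cmin →
    ∀ i → LfpAtLeast Δ i (cmin ^ℚ ((2 ℕ.^ (nVars m g ℕ.+ 1)) ℕ.∸ 1))
lemma4p1 {m} {g} Δ clean cmin (cmin-nonzero , cmin≤coeff) i ε 0<ε with clean i
... | k , 0<iter = k , (begin-strict
  cmin ^ℚ bound - ε                     <⟨ p-ε<p _ 0<ε ⟩
  cmin ^ℚ bound                         ≤⟨ ^ℚ-antitone 0≤cmin cmin≤1 exponent≤bound ⟩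
  cmin ^ℚ mersenne (positiveCount k)    ≤⟨ iter-lowerBound k i 0<iter ⟩
  iter Δ k i                            ∎)
  where
    open TerminationSystem Δ
    open ≤-Reasoning
    n bound : ℕ
    n = nVars m g
    bound = 2 ℕ.^ (n ℕ.+ 1) ℕ.∸ 1
    0≤cmin : 0ℚ ≤ cmin
    0≤cmin = nonzeroCoeff-nonNeg cmin-nonzero
    cmin≤1 : cmin ≤ 1ℚ
    cmin≤1 = let d , d-nonzero , d≤1 = ∃nonzeroCoeff≤1 k i 0<iter in ≤-trans (cmin≤coeff d d-nonzero) d≤1
    open LowerBound Δ 0≤cmin cmin≤1 cmin≤coeff
    exponent≤bound : mersenne (positiveCount k) ℕ.≤ bound
    exponent≤bound = subst (mersenne (positiveCount k) ℕ.≤_) (mersenne≡2^∸1 (n ℕ.+ 1))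
                           (mersenne-mono (ℕₚ.≤-trans (positiveCount≤nVars k) (ℕₚ.m≤m+n n 1)))
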